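{- Let $n\ge0$, $a\in\mathbf{Z}_p$ and $0\le k\le p^n-1$. Then $\mu_a(v_{k,n})-a^kv_{k,n}\in V_{k,n}$ (with $a^k$ reduced modulo $p$); consequently, if $x\in V_{k+1,n}$ then $\mu_a(x)\in V_{k+1,n}$.
   Context: $p$ is a prime, $E$ a finite extension of $\mathbf{F}_p$; binomial coefficients are defined by $(1+X)^j=\sum_i\binom{j}{i}X^i$, in $\mathbf{F}_p$. $V_n$ is the space of sequences $(x_0,\dots,x_{p^n-1})$ in $E$, indices read in $\mathbf{Z}/p^n\mathbf{Z}$. $v_{k,n}=\left(\binom{0}{k},\dots,\binom{p^n-1}{k}\right)$, $V_{k,n}$ is the span of $v_{0,n},\dots,v_{k-1,n}$. For $a\in\mathbf{Z}_p$, $\mu_a:V_n\to V_n$ is $\mu_a(x)_j=x_{aj}$ (index $aj$ taken modulo $p^n$). -}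

module Defs where

open import Level using (Level; _⊔_)
open import Algebra.Bundles using (CommutativeRing)
open import Data.Nat using (ℕ; suc; _<_; _^_; _%_; NonZero)
import Data.Nat as ℕ
open import Data.Nat.Properties using (m^n≢0)
open import Data.Nat.DivMod using (_mod_)
open import Data.Nat.Combinatorics using (_C_)
open import Data.Nat.Primality using (Prime; prime⇒nonZero)
open import Data.Fin using (Fin; toℕ)
open import Data.Product using (Σ; ∃)
open import Relation.Binary.PropositionalEquality using (_≡_)
open import Relation.Nullary using (¬_)
import Algebra.Definitions.RawMonoid as RM

record IsFiniteFieldOfChar {c ℓ : Level} (p : ℕ) (E : CommutativeRing c ℓ) : Set (c ⊔ ℓ) where
  open CommutativeRing E
  open RM +-rawMonoid using () renaming (_×_ to _·ℕ_)
  field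
    one≉zero   : ¬ (1# ≈ 0#)
    inverse    : ∀ x → ¬ (x ≈ 0#) → ∃ λ y → (x * y) ≈ 1#
    char-p     : (p ·ℕ 1#) ≈ 0#
    card       : ℕ
    enum       : Fin card → Carrier
    enum-surj  : ∀ x → ∃ λ i → enum i ≈ x

module _ (p : ℕ) (pp : Prime p) where

  private instance
    p≢0 : NonZero p
    p≢0 = prime⇒nonZero pp

  -- p-adic integers Z_p as the inverse limit of Z/p^m Z:
  -- a compatible system of residues res m ∈ {0,…,p^m - 1}.
  record ℤₚ : Set where
    field
      res     : ℕ → ℕ
      res-<   : ∀ m → res m < p ^ m
      res-compat : ∀ m → _%_ (res (suc m)) (p ^ m) {{m^n≢0 p m}} ≡ res m

  -- a^k reduced modulo p (a mod p is the residue res a 1)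
  powModp : ℤₚ → ℕ → ℕ
  powModp a k = (ℤₚ.res a 1 ^ k) % p

  module _ {c ℓ : Level} (E : CommutativeRing c ℓ) where
    open CommutativeRing E
    open RM +-rawMonoid using (sum) renaming (_×_ to _·ℕ_)

    emb : ℕ → Carrier
    emb m = m ·ℕ 1#

    V : ℕ → Set c
    V n = Fin (p ^ n) → Carrier

    v : ℕ → (n : ℕ) → V n
    v k n j = emb (toℕ j C k)

    μ : ℤₚ → (n : ℕ) → V n → V n
    μ a n x j = x (_mod_ (ℤₚ.res a n ℕ.* toℕ j) (p ^ n) {{m^n≢0 p n}})

    InV : (k n : ℕ) → V n → Set (c ⊔ ℓ)
    InV k n x = Σ (Fin k → Carrier) λ coef →
      ∀ j → x j ≈ sum (λ i → coef i * v (toℕ i) n j)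

{-# OPTIONS --safe #-}
module Submission where

-- Index the coordinates by ℕ and compare with the binomial basis j ↦ C(j,i). A function whose
-- forward difference lies in the span of the C(·,i), i < k, lies in that of the C(·,i), i ≤ k,
-- by Pascal's rule; inductively this shows that j ↦ C(aj+l,k) − a^k C(j,k) lies in the span of
-- the C(·,i), i < k, over any commutative ring. In characteristic p, p divides C(p^n,i) for
-- 0 < i < p^n, so C(·,k) is p^n-periodic when k < p^n and reducing aj modulo p^n changes nothing;
-- likewise a^k only matters modulo p. Finally μ_a is precomposition with j ↦ aj mod p^n, hence
-- linear, and by the first part it maps each v_i with i ≤ k into V_{k+1}.

open import Defs
open import Level using (Level)
open import Algebra.Bundles using (CommutativeRing; Ring)
open import Data.Fin using (Fin; toℕ; fromℕ; inject₁)
open import Data.Fin.Properties using (toℕ-fromℕ; toℕ-inject₁; toℕ<n; toℕ-fromℕ<)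
open import Data.Nat using (ℕ; zero; suc; _<_; _≤_; _^_; s≤s; NonZero)
import Data.Nat as ℕ
import Data.Nat.Properties as ℕₚ
open import Data.Nat.DivMod using (_mod_)
open import Data.Nat.Primality using (Prime)
open import Data.Nat.Tactic.RingSolver using (solve-∀)
open import Data.Product using (_×_; Σ; _,_)
open import Data.Sum using (inj₁; inj₂)
open import Data.Vec.Functional using (insertAt)
open import Data.Vec.Functional.Properties using (insertAt-lookup)
open import Function using (_∘_)
open import Relation.Binary.Bundles using (Setoid)
open import Relation.Binary.PropositionalEquality as ≡ using (_≡_)

module SubtractionLaws {c ℓ} (R : Ring c ℓ) where

  open Ring R
  open import Algebra.Properties.AbelianGroup +-abelianGroup using (⁻¹-∙-comm; ⁻¹-anti-homo‿-; //-rightDividesˡ)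
  open import Algebra.Properties.CommutativeSemigroup +-commutativeSemigroup using (interchange)
  open import Relation.Binary.Reasoning.Setoid setoid

  [x-y]+[y-z]≈x-z : ∀ x y z → (x - y) + (y - z) ≈ x - z
  [x-y]+[y-z]≈x-z x y z = begin
    (x - y) + (y - z)  ≈⟨ +-assoc (x - y) y (- z) ⟨
    ((x - y) + y) - z  ≈⟨ +-congʳ (//-rightDividesˡ y x) ⟩
    x - z              ∎

  [x-x′]+[y-y′]≈[x+y]-[x′+y′] : ∀ x x′ y y′ → (x - x′) + (y - y′) ≈ (x + y) - (x′ + y′)
  [x-x′]+[y-y′]≈[x+y]-[x′+y′] x x′ y y′ = begin
    (x - x′) + (y - y′)       ≈⟨ interchange x (- x′) y (- y′) ⟩
    (x + y) + (- x′ + - y′)   ≈⟨ +-congˡ (⁻¹-∙-comm x′ y′) ⟩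
    (x + y) - (x′ + y′)       ∎

  [x-x′]-[y-y′]≈[x-y]-[x′-y′] : ∀ x x′ y y′ → (x - x′) - (y - y′) ≈ (x - y) - (x′ - y′)
  [x-x′]-[y-y′]≈[x-y]-[x′-y′] x x′ y y′ = begin
    (x - x′) - (y - y′)    ≈⟨ +-congˡ (⁻¹-anti-homo‿- y y′) ⟩
    (x - x′) + (y′ - y)    ≈⟨ interchange x (- x′) y′ (- y) ⟩
    (x + y′) + (- x′ - y)  ≈⟨ +-congˡ (+-comm (- x′) (- y)) ⟩
    (x + y′) + (- y - x′)  ≈⟨ interchange x (- y) y′ (- x′) ⟨
    (x - y) + (y′ - x′)    ≈⟨ +-congˡ (⁻¹-anti-homo‿- x′ y′) ⟨
    (x - y) - (x′ - y′)    ∎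

  [x+z]-[y+z]≈x-y : ∀ x y z → (x + z) - (y + z) ≈ x - y
  [x+z]-[y+z]≈x-y x y z = begin
    (x + z) - (y + z)    ≈⟨ [x-x′]+[y-y′]≈[x+y]-[x′+y′] x y z z ⟨
    (x - y) + (z - z)    ≈⟨ +-congˡ (-‿inverseʳ z) ⟩
    (x - y) + 0#         ≈⟨ +-identityʳ _ ⟩
    x - y                ∎

insertAt-fromℕ-inject₁ : ∀ {a} {A : Set a} {k} (xs : Fin k → A) (x : A) (i : Fin k) →
                         insertAt xs (fromℕ k) x (inject₁ i) ≡ xs i
insertAt-fromℕ-inject₁ xs x Fin.zero    = ≡.refl
insertAt-fromℕ-inject₁ xs x (Fin.suc i) = insertAt-fromℕ-inject₁ (xs ∘ Fin.suc) x i

module LinearSpan {c ℓ a} (R : CommutativeRing c ℓ) {A : Set a} (b : ℕ → A → CommutativeRing.Carrier R) where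

  open CommutativeRing R
  open import Algebra.Properties.Semiring.Sum semiring
    using (sum; sum-cong-≋; sum-replicate-zero; ∑-distrib-+; *-distribˡ-sum; sum-init-last)
  open import Algebra.Properties.Ring ring using (-1*x≈-x)
  open import Algebra.Properties.AbelianGroup +-abelianGroup using (//-rightDividesˡ; x≈y⇒x∙y⁻¹≈ε)
  open import Relation.Binary.Reasoning.Setoid setoid
  open SubtractionLaws ring

  private
    variable
      k : ℕ
      f g h f′ g′ : A → Carrier

  Span : ℕ → (A → Carrier) → Set _
  Span k f = Σ (Fin k → Carrier) λ coef → ∀ j → f j ≈ sum (λ i → coef i * b (toℕ i) j)

  span-resp-≈ : (∀ j → f j ≈ g j) → Span k f → Span k g
  span-resp-≈ f≈g (coef , f≈) = coef , λ j → trans (sym (f≈g j)) (f≈ j)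

  span-zero : ∀ k → Span k (λ _ → 0#)
  span-zero k = (λ _ → 0#) , λ j → sym (trans (sum-cong-≋ {k} (λ i → zeroˡ _)) (sum-replicate-zero k))

  span-+ : Span k f → Span k g → Span k (λ j → f j + g j)
  span-+ {k} (cf , f≈) (cg , g≈) = (λ i → cf i + cg i) , λ j →
    trans (+-cong (f≈ j) (g≈ j))
          (sym (trans (sum-cong-≋ {k} (λ i → distribʳ _ (cf i) (cg i))) (∑-distrib-+ {k} _ _)))

  span-*ˡ : ∀ x → Span k f → Span k (λ j → x * f j)
  span-*ˡ {k} x (cf , f≈) = (λ i → x * cf i) , λ j →
    trans (*-congˡ (f≈ j))
          (sym (trans (sum-cong-≋ {k} (λ i → *-assoc x (cf i) _)) (sym (*-distribˡ-sum {k} x _))))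

  span-sub : Span k f → Span k g → Span k (λ j → f j - g j)
  span-sub span-f span-g = span-+ span-f (span-resp-≈ (λ j → -1*x≈-x _) (span-*ˡ (- 1#) span-g))

  span-sum : ∀ m (fs : Fin m → A → Carrier) → (∀ i → Span k (fs i)) → Span k (λ j → sum (λ i → fs i j))
  span-sum zero    fs spans = span-zero _
  span-sum (suc m) fs spans = span-+ (spans Fin.zero) (span-sum m (fs ∘ Fin.suc) (spans ∘ Fin.suc))

  span-snoc : Span k f → ∀ x → Span (suc k) (λ j → f j + x * b k j)
  span-snoc {k} {f} (cf , f≈) x = coef , λ j → begin
    f j + x * b k j
      ≈⟨ +-cong (f≈ j) (*-cong (reflexive (≡.sym (insertAt-lookup cf (fromℕ k) x)))
                               (reflexive (≡.cong (λ t → b t j) (≡.sym (toℕ-fromℕ k))))) ⟩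
    sum (λ i → cf i * b (toℕ i) j) + coef (fromℕ k) * b (toℕ (fromℕ k)) j
      ≈⟨ +-congʳ (sum-cong-≋ {k} λ i → *-cong (reflexive (≡.sym (insertAt-fromℕ-inject₁ cf x i)))
                                               (reflexive (≡.cong (λ t → b t j) (≡.sym (toℕ-inject₁ i))))) ⟩
    sum (λ i → coef (inject₁ i) * b (toℕ (inject₁ i)) j) + coef (fromℕ k) * b (toℕ (fromℕ k)) j
      ≈⟨ sum-init-last {k} (λ i → coef i * b (toℕ i) j) ⟨
    sum (λ i → coef i * b (toℕ i) j) ∎
    where
      coef : Fin (suc k) → Carrier
      coef = insertAt cf (fromℕ k) x

  span-suc : Span k f → Span (suc k) f
  span-suc {k} span = span-resp-≈ (λ j → trans (+-congˡ (zeroˡ (b k j))) (+-identityʳ _)) (span-snoc span 0#)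

  span-mono : ∀ {k k′} → k ≤ k′ → Span k f → Span k′ f
  span-mono k≤k′ span with ℕₚ.m≤n⇒m<n∨m≡n k≤k′
  ... | inj₂ ≡.refl        = span
  ... | inj₁ (s≤s k≤k′-1) = span-suc (span-mono k≤k′-1 span)

  span-precomp : (σ : A → A) → (∀ i → i < k → Span k (b i ∘ σ)) → Span k f → Span k (f ∘ σ)
  span-precomp {k} σ images (cf , f≈) = span-resp-≈ (λ j → sym (f≈ (σ j)))
    (span-sum k (λ i j → cf i * b (toℕ i) (σ j)) (λ i → span-*ˡ (cf i) (images (toℕ i) (toℕ<n i))))

  infix 4 _≈[_]_
  _≈[_]_ : (A → Carrier) → ℕ → (A → Carrier) → Set _
  f ≈[ k ] g = Span k (λ j → f j - g j)

  ≈[]-reflexive : (∀ j → f j ≈ g j) → f ≈[ k ] g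
  ≈[]-reflexive f≈g = span-resp-≈ (λ j → sym (x≈y⇒x∙y⁻¹≈ε (f≈g j))) (span-zero _)

  ≈[]-trans : f ≈[ k ] g → g ≈[ k ] h → f ≈[ k ] h
  ≈[]-trans f≈g g≈h = span-resp-≈ (λ j → [x-y]+[y-z]≈x-z _ _ _) (span-+ f≈g g≈h)

  ≈[]-+-cong : f ≈[ k ] f′ → g ≈[ k ] g′ → (λ j → f j + g j) ≈[ k ] (λ j → f′ j + g′ j)
  ≈[]-+-cong f≈f′ g≈g′ = span-resp-≈ (λ j → [x-x′]+[y-y′]≈[x+y]-[x′+y′] _ _ _ _) (span-+ f≈f′ g≈g′)

  ≈[]-sub-cong : f ≈[ k ] f′ → g ≈[ k ] g′ → (λ j → f j - g j) ≈[ k ] (λ j → f′ j - g′ j)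
  ≈[]-sub-cong f≈f′ g≈g′ = span-resp-≈ (λ j → [x-x′]-[y-y′]≈[x-y]-[x′-y′] _ _ _ _) (span-sub f≈f′ g≈g′)

  ≈[]⇒span-suc : ∀ x → f ≈[ k ] (λ j → x * b k j) → Span (suc k) f
  ≈[]⇒span-suc x f≈xb = span-resp-≈ (λ j → //-rightDividesˡ _ _) (span-snoc f≈xb x)

span-∘ : ∀ {c ℓ a a′} (R : CommutativeRing c ℓ) {A : Set a} {A′ : Set a′}
         {b : ℕ → A → CommutativeRing.Carrier R} (ι : A′ → A) {k f} →
         LinearSpan.Span R b k f → LinearSpan.Span R (λ i → b i ∘ ι) k (f ∘ ι)
span-∘ R ι (coef , f≈) = coef , f≈ ∘ ι

a[1+j]+l≡aj+[l+a] : ∀ a j l → a ℕ.* suc j ℕ.+ l ≡ a ℕ.* j ℕ.+ (l ℕ.+ a)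
a[1+j]+l≡aj+[l+a] = solve-∀

module BinomialBasis {c ℓ} (R : CommutativeRing c ℓ) where

  open CommutativeRing R
  open import Algebra.Definitions.RawMonoid +-rawMonoid using (sum) renaming (_×_ to _·ℕ_)
  open import Algebra.Properties.Monoid.Mult +-monoid using (×-homo-+; ×-congˡ; ×-assocˡ)
  open import Algebra.Properties.Semiring.Mult semiring using (×-assoc-*)
  open import Algebra.Properties.Semiring.Sum semiring using (sum-cong-≋; sum-replicate-zero; ∑-distrib-+)
  open import Algebra.Properties.AbelianGroup +-abelianGroup using (//-rightDividesˡ)
  open import Algebra.Properties.CommutativeSemigroup +-commutativeSemigroup using (x∙yz≈y∙xz)
  open import Data.Nat.Combinatorics using (_C_; nCk+nC[k+1]≡[n+1]C[k+1])
  open import Data.Vec.Functional using (_∷_)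
  open import Relation.Binary.Reasoning.Setoid setoid
  open SubtractionLaws ring using ([x+z]-[y+z]≈x-y)

  binomial : ℕ → ℕ → Carrier
  binomial i j = (j C i) ·ℕ 1#

  open LinearSpan R binomial

  binomial-pascal : ∀ i j → binomial i j + binomial (suc i) j ≈ binomial (suc i) (suc j)
  binomial-pascal i j = trans (sym (×-homo-+ 1# (j C i) (j C suc i))) (×-congˡ (nCk+nC[k+1]≡[n+1]C[k+1] j i))

  span-suc-of-difference : ∀ {k} (g : ℕ → Carrier) → (g ∘ suc) ≈[ k ] g → Span (suc k) g
  span-suc-of-difference {k} g (coef , Δg≈) = (g 0 ∷ coef) , value
    where
      shifted : ℕ → Carrier
      shifted j = sum (λ i → coef i * binomial (suc (toℕ i)) j)

      value : ∀ j → g j ≈ g 0 * binomial 0 j + shifted j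
      value zero = sym (trans (+-cong (trans (*-congˡ (+-identityʳ 1#)) (*-identityʳ (g 0)))
                                      (trans (sum-cong-≋ {k} (λ i → zeroʳ (coef i))) (sum-replicate-zero k)))
                              (+-identityʳ (g 0)))
      value (suc j) = begin
        g (suc j)
          ≈⟨ //-rightDividesˡ (g j) (g (suc j)) ⟨
        (g (suc j) - g j) + g j
          ≈⟨ +-cong (Δg≈ j) (value j) ⟩
        sum (λ i → coef i * binomial (toℕ i) j) + (g 0 * binomial 0 j + shifted j)
          ≈⟨ x∙yz≈y∙xz _ _ _ ⟩
        g 0 * binomial 0 j + (sum (λ i → coef i * binomial (toℕ i) j) + shifted j)
          ≈⟨ +-congˡ (∑-distrib-+ {k} _ _) ⟨
        g 0 * binomial 0 j + sum (λ i → coef i * binomial (toℕ i) j + coef i * binomial (suc (toℕ i)) j)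
          ≈⟨ +-congˡ (sum-cong-≋ {k} λ i →
               trans (sym (distribˡ (coef i) _ _)) (*-congˡ (binomial-pascal (toℕ i) j))) ⟩
        g 0 * binomial 0 (suc j) + shifted (suc j) ∎

  binomial-dilation : ∀ a l k → (λ j → binomial k (a ℕ.* j ℕ.+ l)) ≈[ k ] (λ j → (a ^ k) ·ℕ 1# * binomial k j)
  binomial-dilation a l zero    = ≈[]-reflexive λ j → sym (trans (*-congʳ (+-identityʳ 1#)) (*-identityˡ _))
  binomial-dilation a l (suc k) = span-suc-of-difference (λ j → F j - G j)
    (≈[]-trans (≈[]-sub-cong F-step G-step) (≈[]-reflexive λ j → [x+z]-[y+z]≈x-y (F j) (G j) (X j)))
    where
      F G X Y : ℕ → Carrier
      F j = binomial (suc k) (a ℕ.* j ℕ.+ l)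
      G j = (a ^ suc k) ·ℕ 1# * binomial (suc k) j
      X j = (a ^ suc k) ·ℕ 1# * binomial k j
      Y j = (a ^ k) ·ℕ 1# * binomial k j

      hockey-stick : ∀ s → (λ j → binomial (suc k) (a ℕ.* j ℕ.+ (l ℕ.+ s))) ≈[ k ] (λ j → F j + s ·ℕ Y j)
      hockey-stick zero = ≈[]-reflexive λ j →
        trans (×-congˡ (≡.cong (λ m → (a ℕ.* j ℕ.+ m) C suc k) (ℕₚ.+-identityʳ l))) (sym (+-identityʳ (F j)))
      hockey-stick (suc s) = ≈[]-trans (≈[]-reflexive pascal)
        (≈[]-trans (≈[]-+-cong (hockey-stick s) (binomial-dilation a (l ℕ.+ s) k)) (≈[]-reflexive regroup))
        where
          pascal : ∀ j → binomial (suc k) (a ℕ.* j ℕ.+ (l ℕ.+ suc s))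
                       ≈ binomial (suc k) (a ℕ.* j ℕ.+ (l ℕ.+ s)) + binomial k (a ℕ.* j ℕ.+ (l ℕ.+ s))
          pascal j = begin
            binomial (suc k) (a ℕ.* j ℕ.+ (l ℕ.+ suc s))
              ≡⟨ ≡.cong (binomial (suc k)) (≡.trans (≡.cong (a ℕ.* j ℕ.+_) (ℕₚ.+-suc l s)) (ℕₚ.+-suc _ _)) ⟩
            binomial (suc k) (suc (a ℕ.* j ℕ.+ (l ℕ.+ s)))
              ≈⟨ binomial-pascal k _ ⟨
            binomial k (a ℕ.* j ℕ.+ (l ℕ.+ s)) + binomial (suc k) (a ℕ.* j ℕ.+ (l ℕ.+ s))
              ≈⟨ +-comm _ _ ⟩
            binomial (suc k) (a ℕ.* j ℕ.+ (l ℕ.+ s)) + binomial k (a ℕ.* j ℕ.+ (l ℕ.+ s)) ∎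

          regroup : ∀ j → (F j + s ·ℕ Y j) + Y j ≈ F j + suc s ·ℕ Y j
          regroup j = trans (+-assoc _ _ _) (+-congˡ (+-comm _ _))

      F-step : (F ∘ suc) ≈[ k ] (λ j → F j + X j)
      F-step = ≈[]-trans (≈[]-reflexive λ j → reflexive (≡.cong (binomial (suc k)) (a[1+j]+l≡aj+[l+a] a j l)))
                         (≈[]-trans (hockey-stick a) (≈[]-reflexive λ j → +-congˡ (a·Y≈X j)))
        where
          a·Y≈X : ∀ j → a ·ℕ Y j ≈ X j
          a·Y≈X j = trans (sym (×-assoc-* a _ _)) (*-congʳ (×-assocˡ 1# a (a ^ k)))

      G-step : (G ∘ suc) ≈[ k ] (λ j → G j + X j)
      G-step = ≈[]-reflexive λ j → begin
        (a ^ suc k) ·ℕ 1# * binomial (suc k) (suc j)                        ≈⟨ *-congˡ (binomial-pascal k j) ⟨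
        (a ^ suc k) ·ℕ 1# * (binomial k j + binomial (suc k) j)            ≈⟨ distribˡ _ _ _ ⟩
        X j + G j                                                          ≈⟨ +-comm _ _ ⟩
        G j + X j                                                          ∎

module _ where

  open import Data.Nat.Combinatorics using (_C_; nCk+nC[k+1]≡[n+1]C[k+1]; nC1≡n)
  open import Data.Nat.Divisibility using (_∣_; divides; _∣?_; 1∣_; m∣m*n; ∣-trans; ∣⇒≤; *-monoʳ-∣; *-cancelˡ-∣)
  open import Data.Nat.Primality using (euclidsLemma; prime⇒nonZero)
  open import Relation.Nullary using (¬_; yes; no; contradiction)
  open import Data.Nat using (_+_; _*_)
  open ℕₚ using (*-distribˡ-+; *-comm; *-assoc; +-assoc)
  open ≡.≡-Reasoning

  [1+k]*[1+m]C[1+k]≡[1+m]*mCk : ∀ m k → suc k * (suc m C suc k) ≡ suc m * (m C k)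
  [1+k]*[1+m]C[1+k]≡[1+m]*mCk m       zero    =
    ≡.trans (ℕₚ.*-identityˡ _) (≡.trans (nC1≡n (suc m)) (≡.sym (ℕₚ.*-identityʳ _)))
  [1+k]*[1+m]C[1+k]≡[1+m]*mCk zero    (suc k) = ℕₚ.*-zeroʳ (suc (suc k))
  [1+k]*[1+m]C[1+k]≡[1+m]*mCk (suc m) (suc k) = begin
    suc (suc k) * (suc (suc m) C suc (suc k))
      ≡⟨ ≡.cong (suc (suc k) *_) (nCk+nC[k+1]≡[n+1]C[k+1] (suc m) (suc k)) ⟨
    suc (suc k) * (X + suc m C suc (suc k))
      ≡⟨ *-distribˡ-+ (suc (suc k)) X _ ⟩
    (X + suc k * X) + suc (suc k) * (suc m C suc (suc k))
      ≡⟨ ≡.cong₂ (λ s t → (X + s) + t) ([1+k]*[1+m]C[1+k]≡[1+m]*mCk m k)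
                                      ([1+k]*[1+m]C[1+k]≡[1+m]*mCk m (suc k)) ⟩
    (X + suc m * (m C k)) + suc m * (m C suc k)
      ≡⟨ +-assoc X _ _ ⟩
    X + (suc m * (m C k) + suc m * (m C suc k))
      ≡⟨ ≡.cong (X +_) (*-distribˡ-+ (suc m) (m C k) (m C suc k)) ⟨
    X + suc m * (m C k + m C suc k)
      ≡⟨ ≡.cong (λ t → X + suc m * t) (nCk+nC[k+1]≡[n+1]C[k+1] m k) ⟩
    suc (suc m) * X ∎
    where X = suc m C suc k

  prime^n∣m*c⇒prime^n∣m : ∀ {p c} → Prime p → ¬ p ∣ c → ∀ n {m} → p ^ n ∣ m * c → p ^ n ∣ m
  prime^n∣m*c⇒prime^n∣m pp p∤c zero {m} _ = 1∣ m
  prime^n∣m*c⇒prime^n∣m {p} {c} pp p∤c (suc n) {m} pⁿ⁺¹∣mc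
    with euclidsLemma m c pp (∣-trans (m∣m*n (p ^ n)) pⁿ⁺¹∣mc)
  ... | inj₂ p∣c = contradiction p∣c p∤c
  ... | inj₁ (divides q ≡.refl) = ≡.subst (p * p ^ n ∣_) (*-comm p q) (*-monoʳ-∣ p pⁿ∣q)
    where
      instance _ = prime⇒nonZero pp
      pⁿ∣qc : p ^ n ∣ q * c
      pⁿ∣qc = *-cancelˡ-∣ p
        (≡.subst (p * p ^ n ∣_) (≡.trans (≡.cong (_* c) (*-comm q p)) (*-assoc p q c)) pⁿ⁺¹∣mc)
      pⁿ∣q : p ^ n ∣ q
      pⁿ∣q = prime^n∣m*c⇒prime^n∣m pp p∤c n pⁿ∣qc

  prime∣[prime^n]C[1+k] : ∀ {p} → Prime p → ∀ n k → suc k < p ^ n → p ∣ (p ^ n) C suc k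
  prime∣[prime^n]C[1+k] {p} pp n k 1+k<pⁿ with p ^ n in pⁿ≡
  ... | zero  = contradiction 1+k<pⁿ ℕₚ.n≮0
  ... | suc m with p ∣? (suc m C suc k)
  ...   | yes p∣C = p∣C
  ...   | no  p∤C = contradiction (∣⇒≤ pⁿ∣1+k) (ℕₚ.<⇒≱ 1+k<pⁿ)
    where
      pⁿ∣1+k : suc m ∣ suc k
      pⁿ∣1+k = ≡.subst (_∣ suc k) pⁿ≡ (prime^n∣m*c⇒prime^n∣m pp p∤C n
                 (≡.subst₂ _∣_ (≡.sym pⁿ≡) (≡.sym ([1+k]*[1+m]C[1+k]≡[1+m]*mCk m k)) (m∣m*n (m C k))))

module _ {c ℓ} (S : Setoid c ℓ) where

  open Setoid S
  open import Data.Nat.DivMod using (_%_; _/_; m≡m%n+[m/n]*n)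

  periodic⇒%-invariant : ∀ N .{{_ : NonZero N}} (f : ℕ → Carrier) → (∀ m → f (m ℕ.+ N) ≈ f m) →
                         ∀ m → f (m % N) ≈ f m
  periodic⇒%-invariant N f periodic m =
    trans (sym (multiple-invariant (m / N))) (reflexive (≡.cong f (≡.sym (m≡m%n+[m/n]*n m N))))
    where
      multiple-invariant : ∀ q → f (m % N ℕ.+ q ℕ.* N) ≈ f (m % N)
      multiple-invariant zero    = reflexive (≡.cong f (ℕₚ.+-identityʳ (m % N)))
      multiple-invariant (suc q) = trans (reflexive (≡.cong f regroup)) (trans (periodic _) (multiple-invariant q))
        where
          regroup : m % N ℕ.+ suc q ℕ.* N ≡ m % N ℕ.+ q ℕ.* N ℕ.+ N
          regroup = ≡.trans (≡.cong (m % N ℕ.+_) (ℕₚ.+-comm N (q ℕ.* N))) (≡.sym (ℕₚ.+-assoc (m % N) (q ℕ.* N) N))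

CharDivides : ∀ {c ℓ} → ℕ → CommutativeRing c ℓ → Set ℓ
CharDivides p R = p ·ℕ 1# ≈ 0#
  where
    open CommutativeRing R
    open import Algebra.Definitions.RawMonoid +-rawMonoid using () renaming (_×_ to _·ℕ_)

module Characteristic {c ℓ} (R : CommutativeRing c ℓ) (p : ℕ) .{{_ : NonZero p}} (char-p : CharDivides p R) where

  open CommutativeRing R
  open import Algebra.Definitions.RawMonoid +-rawMonoid using () renaming (_×_ to _·ℕ_)
  open import Algebra.Properties.Monoid.Mult +-monoid using (×-homo-+)
  open import Algebra.Properties.Semiring.Mult semiring using (×1-homo-*)
  open import Data.Nat.Combinatorics using (_C_)
  open import Data.Nat.DivMod using (_%_)
  open import Data.Nat.Divisibility using (_∣_; divides)
  open BinomialBasis R using (binomial; binomial-pascal)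

  ·ℕ1-mod : ∀ m → (m % p) ·ℕ 1# ≈ m ·ℕ 1#
  ·ℕ1-mod = periodic⇒%-invariant setoid p (_·ℕ 1#) λ m →
    trans (×-homo-+ 1# m p) (trans (+-congˡ char-p) (+-identityʳ _))

  ·ℕ1-^-cong : ∀ {m n} → m % p ≡ n % p → ∀ k → (m ^ k) ·ℕ 1# ≈ (n ^ k) ·ℕ 1#
  ·ℕ1-^-cong m≡n zero    = refl
  ·ℕ1-^-cong {m} {n} m≡n (suc k) =
    trans (×1-homo-* m (m ^ k)) (trans (*-cong m≈n (·ℕ1-^-cong m≡n k)) (sym (×1-homo-* n (n ^ k))))
    where
      m≈n : m ·ℕ 1# ≈ n ·ℕ 1#
      m≈n = trans (sym (·ℕ1-mod m)) (trans (reflexive (≡.cong (_·ℕ 1#) m≡n)) (·ℕ1-mod n))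

  ·ℕ1-multiple : ∀ {m} → p ∣ m → m ·ℕ 1# ≈ 0#
  ·ℕ1-multiple (divides q ≡.refl) = trans (×1-homo-* q p) (trans (*-congˡ char-p) (zeroʳ _))

  module _ (pp : Prime p) where

    binomial-periodic : ∀ n {k} → k < p ^ n → ∀ m → binomial k (m ℕ.+ p ^ n) ≈ binomial k m
    binomial-periodic n {zero}  _      m       = refl
    binomial-periodic n {suc k} 1+k<pⁿ zero    = ·ℕ1-multiple (prime∣[prime^n]C[1+k] pp n k 1+k<pⁿ)
    binomial-periodic n {suc k} 1+k<pⁿ (suc m) = begin
      binomial (suc k) (suc (m ℕ.+ p ^ n))
        ≈⟨ binomial-pascal k _ ⟨
      binomial k (m ℕ.+ p ^ n) + binomial (suc k) (m ℕ.+ p ^ n)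
        ≈⟨ +-cong (binomial-periodic n (ℕₚ.<-trans (ℕₚ.n<1+n k) 1+k<pⁿ) m) (binomial-periodic n 1+k<pⁿ m) ⟩
      binomial k m + binomial (suc k) m
        ≈⟨ binomial-pascal k m ⟩
      binomial (suc k) (suc m) ∎
      where open import Relation.Binary.Reasoning.Setoid setoid

    binomial-mod : ∀ n {k} → k < p ^ n → ∀ m → binomial k (_%_ m (p ^ n) {{ℕₚ.m^n≢0 p n}}) ≈ binomial k m
    binomial-mod n {k} k<pⁿ =
      periodic⇒%-invariant setoid (p ^ n) {{ℕₚ.m^n≢0 p n}} (binomial k) (binomial-periodic n k<pⁿ)

module _ (p : ℕ) (pp : Prime p) where

  open import Data.Nat.DivMod using (_%_; m<n⇒m%n≡m; m∣n⇒o%n%m≡o%m)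
  open import Data.Nat.Divisibility using (m∣m*n)
  open import Data.Nat.Primality using (prime⇒nonZero)

  private instance
    p≢0 : NonZero p
    p≢0 = prime⇒nonZero pp

  res-%-prime : (a : ℤₚ p pp) → ∀ m → ℤₚ.res a (suc m) % p ≡ ℤₚ.res a 1
  res-%-prime a zero    = m<n⇒m%n≡m (≡.subst (ℤₚ.res a 1 <_) (ℕₚ.*-identityʳ p) (ℤₚ.res-< a 1))
  res-%-prime a (suc m) = begin
    ℤₚ.res a (suc (suc m)) % p                  ≡⟨ m∣n⇒o%n%m≡o%m p (p ^ suc m) _ (m∣m*n (p ^ m)) ⟨
    ℤₚ.res a (suc (suc m)) % p ^ suc m % p      ≡⟨ ≡.cong (_% p) (ℤₚ.res-compat a (suc m)) ⟩
    ℤₚ.res a (suc m) % p                        ≡⟨ res-%-prime a m ⟩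
    ℤₚ.res a 1                                  ∎
    where
      open ≡.≡-Reasoning
      instance
        p¹⁺ᵐ≢0 : NonZero (p ^ suc m)
        p¹⁺ᵐ≢0 = ℕₚ.m^n≢0 p (suc m)

  module _ {c ℓ} (E : CommutativeRing c ℓ) where

    open CommutativeRing E
    open import Algebra.Definitions.RawMonoid +-rawMonoid using () renaming (_×_ to _·ℕ_)

    module _ (char-p : CharDivides p E) where

      open Characteristic E p char-p using (·ℕ1-mod; ·ℕ1-^-cong; binomial-mod)
      open BinomialBasis E using (binomial; binomial-dilation)

      ·ℕ1-res^k≈powModp : (a : ℤₚ p pp) → ∀ n k → k < p ^ n →
                          (ℤₚ.res a n ^ k) ·ℕ 1# ≈ emb p pp E (powModp p pp a k)
      ·ℕ1-res^k≈powModp a n       zero    _ = sym (·ℕ1-mod 1)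
      ·ℕ1-res^k≈powModp a zero    (suc k) (s≤s ())
      ·ℕ1-res^k≈powModp a (suc n) (suc k) _ =
        trans (·ℕ1-^-cong (≡.trans (res-%-prime a n) (≡.sym (res-%-prime a 0))) (suc k)) (sym (·ℕ1-mod _))

      module _ (n : ℕ) (a : ℤₚ p pp) where

        private instance
          pⁿ≢0 : NonZero (p ^ n)
          pⁿ≢0 = ℕₚ.m^n≢0 p n

        -- For this family Span unfolds to InV, and f ≈[ k ] g to InV k n of f − g.
        open LinearSpan E (λ i j → v p pp E i n j)
          using (Span; _≈[_]_; ≈[]-reflexive; ≈[]-trans; ≈[]⇒span-suc; span-precomp; span-mono)

        -- μ a n x is x ∘ σ by definition.
        σ : Fin (p ^ n) → Fin (p ^ n)
        σ j = (ℤₚ.res a n ℕ.* toℕ j) mod p ^ n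

        μv≈[]powModp·v : ∀ k → k < p ^ n →
                         μ p pp E a n (v p pp E k n) ≈[ k ] (λ j → emb p pp E (powModp p pp a k) * v p pp E k n j)
        μv≈[]powModp·v k k<pⁿ = ≈[]-trans (≈[]-reflexive index-mod)
          (≈[]-trans (span-∘ E {b = binomial} toℕ (binomial-dilation (ℤₚ.res a n) 0 k))
                     (≈[]-reflexive λ j → *-congʳ (·ℕ1-res^k≈powModp a n k k<pⁿ)))
          where
            index-mod : ∀ j → binomial k (toℕ (σ j)) ≈ binomial k (ℤₚ.res a n ℕ.* toℕ j ℕ.+ 0)
            index-mod j = trans (reflexive (≡.cong (binomial k) (toℕ-fromℕ< _)))
              (trans (binomial-mod pp n k<pⁿ _) (reflexive (≡.cong (binomial k) (≡.sym (ℕₚ.+-identityʳ _)))))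

        μ-preserves-span : ∀ k → k < p ^ n → ∀ x → Span (suc k) x → Span (suc k) (μ p pp E a n x)
        μ-preserves-span k k<pⁿ x = span-precomp σ images
          where
            images : ∀ i → i < suc k → Span (suc k) (v p pp E i n ∘ σ)
            images i (s≤s i≤k) = span-mono (s≤s i≤k) (≈[]⇒span-suc _ (μv≈[]powModp·v i (ℕₚ.≤-<-trans i≤k k<pⁿ)))

lemma1p1p5 : {c ℓ : Level} (p : ℕ) (pp : Prime p) (E : CommutativeRing c ℓ) →
    IsFiniteFieldOfChar p E →
    (n : ℕ) (a : ℤₚ p pp) (k : ℕ) → k < p ^ n →
    InV p pp E k n
      (λ j → CommutativeRing._-_ E (μ p pp E a n (v p pp E k n) j)
        (CommutativeRing._*_ E (emb p pp E (powModp p pp a k)) (v p pp E k n j)))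
    × ((x : V p pp E n) → InV p pp E (suc k) n x → InV p pp E (suc k) n (μ p pp E a n x))
lemma1p1p5 p pp E ff n a k k<pⁿ =
  μv≈[]powModp·v p pp E char-p n a k k<pⁿ , μ-preserves-span p pp E char-p n a k k<pⁿ
  where open IsFiniteFieldOfChar ff using (char-p)
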